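{- Let $p$ be a prime, $\overline x=x_1,\dots,x_N$, and let $\mathcal F\subseteq \mathbb F_p[\overline x]$ be a finite set containing $x_i^2-x_i$ for all $1\le i\le N$. If $\mathcal F$ has an ENS-refutation of some number of levels $\ell\ge 1$ and some accuracy $h\ge 1$, then $\mathcal F$ is unsolvable, i.e. there is no $\overline a\in\mathbb F_p^N$ with $f(\overline a)=0$ for all $f\in\mathcal F$.
   Context: An NS-refutation of a finite set $\mathcal G$ of polynomials over $\mathbb F_p$ (in the variables occurring in $\mathcal G$) is a tuple of polynomials $(h_g)_{g\in\mathcal G}$ such that $\sum_{g\in\mathcal G}h_g g=1$ in the polynomial ring over $\mathbb F_p$ in those variables; its degree is $\max_g \deg(h_g g)$. Extension polynomials: given polynomials $\overline g=g_1,\dots,g_m$ over $\mathbb F_p$ and a parameter $h\ge1$, for $i\le m$ put $E_{i,\overline g}:=g_i\cdot\prod_{u\le h}\bigl(1-\sum_{j\le m}r_{uj}g_j\bigr)$, where $r_{uj}$ are new (extension) variables common to all $i\le m$; these are the extension polynomials of accuracy $h$ corresponding to $\overline g$, and $E_{1,\overline g},\dots,E_{m,\overline g}$ are called companions. A set $\mathcal E$ of extension polynomials is stratified into $\ell$ levels if it can be partitioned as $\mathcal E_1\cup\dots\cup\mathcal E_\ell$ such that: (i) if $E_{i,\overline g}\in\mathcal E_t$ then all companions $E_{j,\overline g}$, $j\le m$, are in $\mathcal E_t$; (ii) for $E_{i,\overline g}\in\mathcal E_1$, the variables of the $g_j$ are among $Var(\mathcal F)$, and no extension variable of $E_{i,\overline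 g}$ occurs in $Var(\mathcal F)$ or in other polynomials of $\mathcal E_1$ except the companions; (iii) for $E_{i,\overline g}\in\mathcal E_{t+1}$, $1\le t<\ell$, the variables of the $g_j$ are among the variables occurring in $\mathcal F\cup\bigcup_{s\le t}\mathcal E_s$ (including their extension variables), and no extension variable of $E_{i,\overline g}$ occurs among these or in other polynomials of $\mathcal E_{t+1}$ except the companions. $\mathcal R(\mathcal E)$ denotes the set of polynomials $r^p-r$ for all extension variables $r$ occurring in $\mathcal E$. An ENS-refutation of $\mathcal F$ is a triple $(h,\mathcal E,L)$ where $h\ge1$ (the accuracy), $\mathcal E$ is a set of extension polynomials of accuracy $h$ stratified into some number $\ell$ of levels, and $L$ is an NS-refutation of $\mathcal F\cup\mathcal E\cup\mathcal R(\mathcal E)$; its degree is the degree of $L$. -}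

module Defs where

open import Data.Nat as ℕ using (ℕ; zero; suc; _≤_; _<_; _≤?_; _<?_)
open import Data.Integer as ℤ using (ℤ; +_; _-_)
open import Data.Integer.Divisibility using (_∣_)
open import Data.Fin using (Fin; toℕ; fromℕ<)
open import Data.List using (List; []; _∷_; _++_; foldr; map; concat; concatMap; length)
open import Data.List as List using (tabulate; lookup)
open import Data.List.Properties using (≡-dec)
open import Data.List.Membership.Propositional using (_∈_)
open import Data.List.Relation.Unary.Any using (Any)
open import Data.Product using (Σ; ∃; _×_; _,_)
open import Data.Unit using (⊤)
open import Relation.Nullary using (¬_; yes; no)
open import Relation.Binary.PropositionalEquality using (_≡_; _≢_)

-- Variables are natural numbers; a monomial is a list of variables
-- (a multiset: order is irrelevant), a term is (integer coefficient,
-- monomial).  The field F_p is realised as ℤ modulo p: coefficients are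
-- integers, and two polynomials are equal in F_p[vars] iff every
-- monomial has congruent coefficients mod p.

Monomial : Set
Monomial = List ℕ

Poly : Set
Poly = List (ℤ × Monomial)

insertM : ℕ → List ℕ → List ℕ
insertM x [] = x ∷ []
insertM x (y ∷ ys) with x ≤? y
... | yes _ = x ∷ y ∷ ys
... | no  _ = y ∷ insertM x ys

sortM : Monomial → Monomial
sortM = foldr insertM []

coeff : Poly → Monomial → ℤ
coeff [] m = + 0
coeff ((c , m') ∷ P) m with ≡-dec ℕ._≟_ (sortM m') (sortM m)
... | yes _ = c ℤ.+ coeff P m
... | no  _ = coeff P m

constP : ℤ → Poly
constP c = (c , []) ∷ []

zeroP : Poly
zeroP = []

oneP : Poly
oneP = constP (+ 1)

var : ℕ → Poly
var v = (+ 1 , v ∷ []) ∷ []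

_⊕_ : Poly → Poly → Poly
P ⊕ Q = P ++ Q

negP : Poly → Poly
negP = map (λ { (c , m) → (ℤ.- c , m) })

_⊖_ : Poly → Poly → Poly
P ⊖ Q = P ⊕ negP Q

_⊗_ : Poly → Poly → Poly
P ⊗ Q = concatMap (λ { (c , m) → map (λ { (d , n) → (c ℤ.* d , m ++ n) }) Q }) P

powP : Poly → ℕ → Poly
powP P zero = oneP
powP P (suc n) = P ⊗ powP P n

sumF : {n : ℕ} → (Fin n → Poly) → Poly
sumF f = foldr _⊕_ zeroP (tabulate f)

prodF : {n : ℕ} → (Fin n → Poly) → Poly
prodF f = foldr _⊗_ oneP (tabulate f)

_≈[_]_ : Poly → ℕ → Poly → Set
P ≈[ p ] Q = ∀ (m : Monomial) → (+ p) ∣ (coeff P m - coeff Q m)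

Occurs : ℕ → ℕ → Poly → Set
Occurs p v P = ∃ λ (m : Monomial) → v ∈ m × ¬ ((+ p) ∣ coeff P m)

OccursIn : ℕ → ℕ → List Poly → Set
OccursIn p v S = Any (Occurs p v) S

evalP : (ℕ → ℤ) → Poly → ℤ
evalP env P = foldr ℤ._+_ (+ 0)
  (map (λ { (c , m) → c ℤ.* foldr ℤ._*_ (+ 1) (map env m) }) P)

NSRefutation : ℕ → List Poly → Set
NSRefutation p G =
  Σ (Fin (length G) → Poly) λ hs → sumF (λ i → hs i ⊗ lookup G i) ≈[ p ] oneP

-- Extension polynomials of accuracy h.
-- A group ḡ = g_1..g_m together with its extension variables r_{uj}
-- (u ≤ h, j ≤ m); it determines the m companions E_{1,ḡ},...,E_{m,ḡ}.

record ExtGroup (h : ℕ) : Set where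
  constructor extGroup
  field
    m  : ℕ
    gs : Fin m → Poly
    r  : Fin h → Fin m → ℕ

open ExtGroup public

extPoly : {h : ℕ} (G : ExtGroup h) → Fin (m G) → Poly
extPoly {h} G i =
  gs G i ⊗ prodF {h} (λ u → oneP ⊖ sumF {m G} (λ j → var (r G u j) ⊗ gs G j))

groupPolys : {h : ℕ} → ExtGroup h → List Poly
groupPolys G = tabulate (extPoly G)

extVarList : {h : ℕ} → ExtGroup h → List ℕ
extVarList {h} G = concat (tabulate {n = h} (λ u → tabulate (λ j → r G u j)))

levelPolys : {h : ℕ} → List (ExtGroup h) → List Poly
levelPolys = concatMap groupPolys

-- conditions for the k-th group of a level, where `prev` is the list of
-- F together with all polynomials of earlier levels
GroupOK : {h : ℕ} → ℕ → List Poly → (L : List (ExtGroup h)) → Fin (length L) → Set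
GroupOK p prev L k =
  let G = lookup L k in
  (∀ u j u' j' → r G u j ≡ r G u' j' → (u ≡ u') × (j ≡ j'))
  × (∀ j v → Occurs p v (gs G j) → OccursIn p v prev)
  × (∀ u j → ¬ OccursIn p (r G u j) prev)
  × (∀ u j (k' : Fin (length L)) → k' ≢ k →
        ¬ OccursIn p (r G u j) (groupPolys (lookup L k')))

Stratified : {h : ℕ} → ℕ → List Poly → List (List (ExtGroup h)) → Set
Stratified p prev [] = ⊤
Stratified p prev (L ∷ Ls) =
  (∀ (k : Fin (length L)) → GroupOK p prev L k)
  × Stratified p (prev ++ levelPolys L) Ls

allExtPolys : {h : ℕ} → List (List (ExtGroup h)) → List Poly
allExtPolys = concatMap levelPolys

RPolys : {h : ℕ} → ℕ → List (List (ExtGroup h)) → List Poly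
RPolys p E =
  map (λ v → powP (var v) p ⊖ var v) (concatMap (concatMap extVarList) E)

ENSRefutation : ℕ → List Poly → Set
ENSRefutation p F =
  Σ ℕ λ h → 1 ≤ h ×
  Σ (List (List (ExtGroup h))) λ E → 1 ≤ length E ×
    Stratified p F E × NSRefutation p (F ++ allExtPolys E ++ RPolys p E)

-- the variables x_1..x_N are the variables 0..N-1; an assignment
-- ā ∈ F_p^N is extended by 0 to the other variables

assignEnv : {N p : ℕ} → (Fin N → Fin p) → ℕ → ℤ
assignEnv {N} a v with v <? N
... | yes v<N = + toℕ (a (fromℕ< v<N))
... | no  _   = + 0

-- Suppose ā is a zero of F modulo p. It extends, level by level and group by group, to a zero of
-- all extension polynomials: for a group g_1, ..., g_m, either every g_j vanishes at the current
-- point, or some g_j₀ does not, and then r_1j₀ := g_j₀^(p-2), its inverse by Fermat's little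
-- theorem, and r_1j := 0 for j ≠ j₀ kill the first factor 1 - Σ_j r_1j g_j of every companion.
-- The stratification guarantees that the new variables occur neither in the g_j nor in any
-- polynomial made to vanish earlier, so these keep their values modulo p. By Fermat, every
-- r^p - r vanishes as well, and evaluating the NS-refutation at the extended point gives 1 ≡ 0.
--
-- Polynomials are formal lists of terms, so the technical core is that the value of a polynomial
-- modulo p depends only on its coefficients modulo p and on the variables that occur in it.
module Submission where

open import Defs
open import Data.Nat as ℕ using (ℕ; zero; suc; _<_; _∸_; z<s; s<s)
import Data.Nat.Properties as ℕP
import Data.Nat.Divisibility as ℕ∣
open import Data.Nat.Combinatorics
  using (_C_; nC1≡n; nCn≡1) renaming (nCk+nC[k+1]≡[n+1]C[k+1] to pascal)
open import Data.Nat.Primality using (Prime; euclidsLemma; ¬prime[0]; ¬prime[1])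
import Data.Nat.Tactic.RingSolver as ℕ-Ring
open import Data.Integer as ℤ using (ℤ; +_; -[1+_]; 0ℤ; 1ℤ; _+_; _-_; -_; _*_; _^_; +-*-rawSemiring)
open import Data.Integer.Properties
open import Data.Integer.Tactic.RingSolver using (solve-∀)
open import Algebra.Definitions.RawSemiring +-*-rawSemiring
  using (product) renaming (_^_ to _^ₛ_; _×_ to _×ₛ_)
import Algebra.Properties.CommutativeSemiring.Binomial as Binomial
import Algebra.Properties.CommutativeMonoid.Sum as CommutativeMonoidSum
open import Data.Fin using (Fin; zero; suc; toℕ; inject₁; punchIn)
open import Data.Fin.Properties
  using (toℕ-inject₁; toℕ<n; toℕ-fromℕ; punchInᵢ≢i; suc-injective; any?; all?; ¬∀⟶∃¬)
open import Data.Vec.Functional using (Vector; init; last; updateAt)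
open import Data.Vec.Functional.Properties using (updateAt-updates; updateAt-minimal)
open import Data.List using (List; []; _∷_; _++_; map; foldr; filter; length; lookup)
open import Data.List.Properties using (≡-dec; length-filter; filter-reject; ++-assoc)
open import Data.List.Membership.Propositional.Properties using (∈-lookup)
open import Data.List.Relation.Binary.Permutation.Propositional
  using (_↭_; ↭-refl; ↭-prep; ↭-swap; ↭-trans; ↭⇒↭ₛ)
open import Data.List.Relation.Binary.Permutation.Propositional.Properties using (map⁺; ∈-resp-↭)
open import Relation.Binary.PropositionalEquality
open import Data.List.Relation.Binary.Permutation.Setoid.Properties (setoid ℤ) using (foldr-commMonoid)
open import Data.List.Relation.Unary.All as All using (All; []; _∷_)
import Data.List.Relation.Unary.All.Properties as AllP
open import Data.List.Relation.Unary.Any using (Any; here; there)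
import Data.List.Relation.Unary.Any.Properties as AnyP
open import Data.Product using (Σ; ∃₂; _×_; _,_; proj₂)
open import Data.Sum using (_⊎_; inj₁; inj₂; fromInj₂)
import Data.Sum as Sum
open import Function using (_∘_; const)
open import Relation.Nullary using (¬_; yes; no; contradiction)
open import Relation.Unary using (Pred; Decidable; ∁)
open import Relation.Unary.Properties using (∁?)

-- The development uses signed divisibility; only the final statement uses the unsigned relation
-- of Data.Integer.Divisibility, which is why the two are kept in separate scopes.
module Soundness where

  open import Data.Integer.Divisibility.Signed
    using (_∣_; _∣?_; divides; ∣ᵤ⇒∣; ∣⇒∣ᵤ; ∣m⇒∣m*n; ∣n⇒∣m*n; ∣m⇒∣-m; ∣m∣n⇒∣m+n; ∣m∣n⇒∣m-n)
  module ℤ-Binomial = Binomial +-*-commutativeSemiring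
  open CommutativeMonoidSum +-0-commutativeMonoid
    using (sum; sum-init-last; sum-remove; sum-cong-≗; sum-replicate-zero)

  ∣m-n∣n⇒∣m : ∀ {d m n} → d ∣ m - n → d ∣ n → d ∣ m
  ∣m-n∣n⇒∣m {d} {m} {n} d∣m-n d∣n = subst (d ∣_) (m-n+n≡m m n) (∣m∣n⇒∣m+n d∣m-n d∣n)
    where
    m-n+n≡m : ∀ m n → m - n + n ≡ m
    m-n+n≡m = solve-∀

  ∣m-n∣m⇒∣n : ∀ {d m n} → d ∣ m - n → d ∣ m → d ∣ n
  ∣m-n∣m⇒∣n {d} {m} {n} d∣m-n d∣m = subst (d ∣_) (m-[m-n]≡n m n) (∣m∣n⇒∣m-n d∣m d∣m-n)
    where
    m-[m-n]≡n : ∀ m n → m - (m - n) ≡ n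
    m-[m-n]≡n = solve-∀

  prime∣m*n⇒∣m⊎∣n : ∀ {p} → Prime p → ∀ m n → + p ∣ m * n → + p ∣ m ⊎ + p ∣ n
  prime∣m*n⇒∣m⊎∣n {p} p-prime m n p∣mn = Sum.map ∣ᵤ⇒∣ ∣ᵤ⇒∣
    (euclidsLemma ℤ.∣ m ∣ ℤ.∣ n ∣ p-prime (subst (p ℕ∣.∣_) (abs-* m n) (∣⇒∣ᵤ p∣mn)))

  ∣-sum : ∀ {d n} (t : Vector ℤ n) → (∀ i → d ∣ t i) → d ∣ sum t
  ∣-sum {n = zero}  t d∣t = divides 0ℤ refl
  ∣-sum {n = suc n} t d∣t = ∣m∣n⇒∣m+n (d∣t zero) (∣-sum (t ∘ suc) (d∣t ∘ suc))

  sum-single : ∀ {n} (t : Vector ℤ n) i → (∀ j → j ≢ i → t j ≡ 0ℤ) → sum t ≡ t i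
  sum-single {suc n} t i t≡0 = begin
    sum t                     ≡⟨ sum-remove t ⟩
    t i + sum (t ∘ punchIn i) ≡⟨ cong (_+_ (t i)) (sum-cong-≗ (λ j → t≡0 (punchIn i j) (punchInᵢ≢i i j))) ⟩
    t i + sum {n} (const 0ℤ)  ≡⟨ cong (_+_ (t i)) (sum-replicate-zero n) ⟩
    t i + 0ℤ                  ≡⟨ +-identityʳ (t i) ⟩
    t i                       ∎
    where open ≡-Reasoning

  -- Fermat's little theorem

  [k+1]*[n+1]C[k+1]≡[n+1]*nCk : ∀ n k → suc k ℕ.* (suc n C suc k) ≡ suc n ℕ.* (n C k)
  [k+1]*[n+1]C[k+1]≡[n+1]*nCk zero    zero    = refl
  [k+1]*[n+1]C[k+1]≡[n+1]*nCk zero    (suc k) = ℕP.*-zeroʳ (2 ℕ.+ k)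
  [k+1]*[n+1]C[k+1]≡[n+1]*nCk (suc n) zero    =
    trans (ℕP.+-identityʳ _) (trans (nC1≡n (2 ℕ.+ n)) (sym (ℕP.*-identityʳ _)))
  [k+1]*[n+1]C[k+1]≡[n+1]*nCk (suc n) (suc k) = begin
    (2 ℕ.+ k) ℕ.* (suc N C (2 ℕ.+ k))           ≡⟨ cong ((2 ℕ.+ k) ℕ.*_) (sym (pascal N (suc k))) ⟩
    (2 ℕ.+ k) ℕ.* (A ℕ.+ B)                     ≡⟨ regroup k A B ⟩
    A ℕ.+ (suc k ℕ.* A ℕ.+ (2 ℕ.+ k) ℕ.* B)
      ≡⟨ cong₂ (λ a b → A ℕ.+ (a ℕ.+ b)) ([k+1]*[n+1]C[k+1]≡[n+1]*nCk n k) ([k+1]*[n+1]C[k+1]≡[n+1]*nCk n (suc k)) ⟩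
    A ℕ.+ (N ℕ.* (n C k) ℕ.+ N ℕ.* (n C suc k)) ≡⟨ cong (A ℕ.+_) (ℕP.*-distribˡ-+ N (n C k) (n C suc k)) ⟨
    A ℕ.+ N ℕ.* (n C k ℕ.+ n C suc k)           ≡⟨ cong (λ a → A ℕ.+ N ℕ.* a) (pascal n k) ⟩
    suc N ℕ.* A                                 ∎
    where
    open ≡-Reasoning
    N A B : ℕ
    N = suc n
    A = N C suc k
    B = N C (2 ℕ.+ k)
    regroup : ∀ k a b → (2 ℕ.+ k) ℕ.* (a ℕ.+ b) ≡ a ℕ.+ (suc k ℕ.* a ℕ.+ (2 ℕ.+ k) ℕ.* b)
    regroup = ℕ-Ring.solve-∀

  prime∣pCk : ∀ {p k} → Prime p → 0 < k → k < p → p ℕ∣.∣ p C k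
  prime∣pCk {suc n} {suc k} p-prime _ k<p
    with euclidsLemma (suc k) (suc n C suc k) p-prime
           (ℕ∣.divides (n C k) (trans ([k+1]*[n+1]C[k+1]≡[n+1]*nCk n k) (ℕP.*-comm (suc n) (n C k))))
  ... | inj₁ p∣k+1 = contradiction (ℕ∣.∣⇒≤ p∣k+1) (ℕP.<⇒≱ k<p)
  ... | inj₂ p∣pCk = p∣pCk

  -- The library's binomial theorem is phrased with the generic semiring power and ℕ-multiple.
  ^ₛ≡^ : ∀ x n → x ^ₛ n ≡ x ^ n
  ^ₛ≡^ x zero    = refl
  ^ₛ≡^ x (suc n) = cong (x *_) (^ₛ≡^ x n)

  ×ₛ≡* : ∀ n x → n ×ₛ x ≡ + n * x
  ×ₛ≡* zero    x = sym (*-zeroˡ x)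
  ×ₛ≡* (suc n) x = trans (cong (_+_ x) (×ₛ≡* n x)) (sym (suc-* (+ n) x))

  freshmans-dream : ∀ {p} → Prime p → ∀ x → + p ∣ (1ℤ + x) ^ p - (1ℤ + x ^ p)
  freshmans-dream {zero}  p-prime = contradiction p-prime ¬prime[0]
  freshmans-dream {suc n} p-prime x = subst (+ p ∣_) (sym middle≡) (∣-sum middle p∣middle)
    where
    open ≡-Reasoning
    p : ℕ
    p = suc n
    term : Vector ℤ (suc p)
    term = ℤ-Binomial.binomialTerm 1ℤ x p
    middle : Vector ℤ n
    middle = init (term ∘ suc)
    p∣middle : ∀ i → + p ∣ middle i
    p∣middle i = subst (+ p ∣_) (sym (×ₛ≡* (p C k) monomial))
      (∣m⇒∣m*n monomial (∣ᵤ⇒∣ {i = + (p C k)} (prime∣pCk p-prime z<s k<p)))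
      where
      k : ℕ
      k = suc (toℕ (inject₁ i))
      k<p : k < p
      k<p = s<s (subst (ℕ._< n) (sym (toℕ-inject₁ i)) (toℕ<n i))
      monomial : ℤ
      monomial = ℤ-Binomial.binomial 1ℤ x p (suc (inject₁ i))
    first : term zero ≡ x ^ p
    first = trans (+-identityʳ _) (trans (*-identityˡ _) (^ₛ≡^ x p))
    final : last (term ∘ suc) ≡ 1ℤ
    final rewrite toℕ-fromℕ n | nCn≡1 p | ℕP.n∸n≡0 n =
      trans (+-identityʳ _) (trans (*-identityʳ _) (trans (^ₛ≡^ 1ℤ p) (^-zeroˡ p)))
    cancel : ∀ m a b → (a + (m + b)) - (b + a) ≡ m
    cancel = solve-∀
    middle≡ : (1ℤ + x) ^ p - (1ℤ + x ^ p) ≡ sum middle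
    middle≡ = begin
      (1ℤ + x) ^ p - (1ℤ + x ^ p)
        ≡⟨ cong (_- (1ℤ + x ^ p)) (trans (sym (^ₛ≡^ (1ℤ + x) p)) (ℤ-Binomial.theorem p 1ℤ x)) ⟩
      (term zero + sum (term ∘ suc)) - (1ℤ + x ^ p)
        ≡⟨ cong (λ s → (term zero + s) - (1ℤ + x ^ p)) (sum-init-last (term ∘ suc)) ⟩
      (term zero + (sum middle + last (term ∘ suc))) - (1ℤ + x ^ p)
        ≡⟨ cong₂ (λ a b → (a + (sum middle + b)) - (1ℤ + x ^ p)) first final ⟩
      (x ^ p + (sum middle + 1ℤ)) - (1ℤ + x ^ p)
        ≡⟨ cancel (sum middle) (x ^ p) 1ℤ ⟩
      sum middle ∎

  fermat-step : ∀ {p} → Prime p → ∀ x → + p ∣ ((1ℤ + x) ^ p - (1ℤ + x)) - (x ^ p - x)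
  fermat-step {p} p-prime x = subst (+ p ∣_) (regroup ((1ℤ + x) ^ p) (x ^ p) x) (freshmans-dream p-prime x)
    where
    regroup : ∀ a b x → a - (1ℤ + b) ≡ (a - (1ℤ + x)) - (b - x)
    regroup = solve-∀

  fermat : ∀ {p} → Prime p → ∀ x → + p ∣ x ^ p - x
  fermat {zero}  p-prime = contradiction p-prime ¬prime[0]
  fermat {suc n} p-prime (+ zero)     = divides 0ℤ refl
  fermat {suc n} p-prime (+ suc m)    = ∣m-n∣n⇒∣m (fermat-step p-prime (+ m)) (fermat p-prime (+ m))
  fermat {suc n} p-prime -[1+ zero ]  = ∣m-n∣m⇒∣n (fermat-step p-prime -[1+ 0 ]) (fermat p-prime 0ℤ)
  fermat {suc n} p-prime -[1+ suc m ] =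
    ∣m-n∣m⇒∣n (fermat-step p-prime -[1+ suc m ]) (fermat p-prime -[1+ m ])

  fermat-inverse : ∀ {p} → Prime p → ∀ {g} → ¬ + p ∣ g → + p ∣ g ^ (p ∸ 2) * g - 1ℤ
  fermat-inverse {0}           p-prime = contradiction p-prime ¬prime[0]
  fermat-inverse {1}           p-prime = contradiction p-prime ¬prime[1]
  fermat-inverse {suc (suc k)} p-prime {g} p∤g =
    fromInj₂ (λ p∣g → contradiction p∣g p∤g) (prime∣m*n⇒∣m⊎∣n p-prime g (g ^ k * g - 1ℤ) p∣g[g^[p-2]g-1])
    where
    factor : ∀ g h → g * (g * h) - g ≡ g * (h * g - 1ℤ)
    factor = solve-∀
    p∣g[g^[p-2]g-1] : + (2 ℕ.+ k) ∣ g * (g ^ k * g - 1ℤ)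
    p∣g[g^[p-2]g-1] = subst (+ (2 ℕ.+ k) ∣_) (factor g (g ^ k)) (fermat p-prime g)

  -- Evaluating polynomials

  insertM-↭ : ∀ x xs → insertM x xs ↭ x ∷ xs
  insertM-↭ x []       = ↭-refl
  insertM-↭ x (y ∷ ys) with x ℕ.≤? y
  ... | yes _ = ↭-refl
  ... | no  _ = ↭-trans (↭-prep y (insertM-↭ x ys)) (↭-swap y x ↭-refl)

  sortM-↭ : ∀ m → sortM m ↭ m
  sortM-↭ []      = ↭-refl
  sortM-↭ (x ∷ m) = ↭-trans (insertM-↭ x (sortM m)) (↭-prep x (sortM-↭ m))

  module _ (env : ℕ → ℤ) where

    evalM : Monomial → ℤ
    evalM m = foldr _*_ 1ℤ (map env m)

    evalM-sortM : ∀ m → evalM (sortM m) ≡ evalM m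
    evalM-sortM m = foldr-commMonoid *-1-isCommutativeMonoid (↭⇒↭ₛ (map⁺ env (sortM-↭ m)))

    evalM-++ : ∀ m n → evalM (m ++ n) ≡ evalM m * evalM n
    evalM-++ []      n = sym (*-identityˡ (evalM n))
    evalM-++ (v ∷ m) n = trans (cong (env v *_) (evalM-++ m n)) (sym (*-assoc (env v) (evalM m) (evalM n)))

    evalP-++ : ∀ P Q → evalP env (P ++ Q) ≡ evalP env P + evalP env Q
    evalP-++ []            Q = sym (+-identityˡ (evalP env Q))
    evalP-++ ((c , m) ∷ P) Q =
      trans (cong (_+_ (c * evalM m)) (evalP-++ P Q))
            (sym (+-assoc (c * evalM m) (evalP env P) (evalP env Q)))

    evalP-negP : ∀ P → evalP env (negP P) ≡ - evalP env P
    evalP-negP []            = refl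
    evalP-negP ((c , m) ∷ P) =
      trans (cong₂ _+_ (sym (neg-distribˡ-* c (evalM m))) (evalP-negP P))
            (sym (neg-distrib-+ (c * evalM m) (evalP env P)))

    evalP-⊖ : ∀ P Q → evalP env (P ⊖ Q) ≡ evalP env P - evalP env Q
    evalP-⊖ P Q = trans (evalP-++ P (negP Q)) (cong (_+_ (evalP env P)) (evalP-negP Q))

    evalP-scale : ∀ c m (f : ℤ × Monomial → ℤ × Monomial) → (∀ d n → f (d , n) ≡ (c * d , m ++ n)) →
                  ∀ Q → evalP env (map f Q) ≡ c * evalM m * evalP env Q
    evalP-scale c m f f-spec []            = sym (*-zeroʳ (c * evalM m))
    evalP-scale c m f f-spec ((d , n) ∷ Q) rewrite f-spec d n = begin
      c * d * evalM (m ++ n) + evalP env (map f Q)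
        ≡⟨ cong₂ _+_ (cong (_*_ (c * d)) (evalM-++ m n)) (evalP-scale c m f f-spec Q) ⟩
      c * d * (evalM m * evalM n) + c * evalM m * evalP env Q
        ≡⟨ factor c d (evalM m) (evalM n) (evalP env Q) ⟩
      c * evalM m * (d * evalM n + evalP env Q) ∎
      where
      open ≡-Reasoning
      factor : ∀ c d x y z → c * d * (x * y) + c * x * z ≡ c * x * (d * y + z)
      factor = solve-∀

    evalP-⊗ : ∀ P Q → evalP env (P ⊗ Q) ≡ evalP env P * evalP env Q
    evalP-⊗ []            Q = refl
    evalP-⊗ ((c , m) ∷ P) Q = begin
      evalP env (map _ Q ++ P ⊗ Q)
        ≡⟨ evalP-++ (map _ Q) (P ⊗ Q) ⟩
      evalP env (map _ Q) + evalP env (P ⊗ Q)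
        ≡⟨ cong₂ _+_ (evalP-scale c m _ (λ _ _ → refl) Q) (evalP-⊗ P Q) ⟩
      c * evalM m * evalP env Q + evalP env P * evalP env Q
        ≡⟨ *-distribʳ-+ (evalP env Q) (c * evalM m) (evalP env P) ⟨
      (c * evalM m + evalP env P) * evalP env Q ∎
      where open ≡-Reasoning

    evalP-var : ∀ v → evalP env (var v) ≡ env v
    evalP-var v = trans (+-identityʳ _) (trans (*-identityˡ _) (*-identityʳ (env v)))

    evalP-powP : ∀ P n → evalP env (powP P n) ≡ evalP env P ^ n
    evalP-powP P zero    = refl
    evalP-powP P (suc n) = trans (evalP-⊗ P (powP P n)) (cong (_*_ (evalP env P)) (evalP-powP P n))

    evalP-sumF : ∀ {n} (f : Fin n → Poly) → evalP env (sumF f) ≡ sum (evalP env ∘ f)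
    evalP-sumF {zero}  f = refl
    evalP-sumF {suc n} f =
      trans (evalP-++ (f zero) _) (cong (_+_ (evalP env (f zero))) (evalP-sumF (f ∘ suc)))

    evalP-prodF : ∀ {n} (f : Fin n → Poly) → evalP env (prodF f) ≡ product (evalP env ∘ f)
    evalP-prodF {zero}  f = refl
    evalP-prodF {suc n} f =
      trans (evalP-⊗ (f zero) _) (cong (_*_ (evalP env (f zero))) (evalP-prodF (f ∘ suc)))

  -- Coefficients determine values modulo p

  coeff-++ : ∀ P Q m → coeff (P ++ Q) m ≡ coeff P m + coeff Q m
  coeff-++ []             Q m = sym (+-identityˡ _)
  coeff-++ ((c , m′) ∷ P) Q m with ≡-dec ℕ._≟_ (sortM m′) (sortM m)
  ... | yes _ = trans (cong (_+_ c) (coeff-++ P Q m)) (sym (+-assoc c (coeff P m) (coeff Q m)))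
  ... | no  _ = coeff-++ P Q m

  coeff-negP : ∀ P m → coeff (negP P) m ≡ - coeff P m
  coeff-negP []             m = refl
  coeff-negP ((c , m′) ∷ P) m with ≡-dec ℕ._≟_ (sortM m′) (sortM m)
  ... | yes _ = trans (cong (_+_ (- c)) (coeff-negP P m)) (sym (neg-distrib-+ c (coeff P m)))
  ... | no  _ = coeff-negP P m

  coeff-⊖ : ∀ P Q m → coeff (P ⊖ Q) m ≡ coeff P m - coeff Q m
  coeff-⊖ P Q m = trans (coeff-++ P (negP Q) m) (cong (_+_ (coeff P m)) (coeff-negP Q m))

  -- As in coeff, a term is classified by its sorted monomial.
  select : ∀ {ℓ} {Q : Pred Monomial ℓ} → Decidable Q → Poly → Poly
  select Q? = filter (λ t → Q? (sortM (proj₂ t)))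

  module _ {ℓ} {Q : Pred Monomial ℓ} (Q? : Decidable Q) where

    coeff-select-∈ : ∀ P m → Q (sortM m) → coeff (select Q? P) m ≡ coeff P m
    coeff-select-∈ []             m q = refl
    coeff-select-∈ ((c , m′) ∷ P) m q with Q? (sortM m′)
    ... | yes _ with ≡-dec ℕ._≟_ (sortM m′) (sortM m)
    ...   | yes _ = cong (_+_ c) (coeff-select-∈ P m q)
    ...   | no  _ = coeff-select-∈ P m q
    coeff-select-∈ ((c , m′) ∷ P) m q | no ¬q′ with ≡-dec ℕ._≟_ (sortM m′) (sortM m)
    ...   | yes m′≡m = contradiction (subst Q (sym m′≡m) q) ¬q′
    ...   | no  _    = coeff-select-∈ P m q

    coeff-select-∉ : ∀ P m → ¬ Q (sortM m) → coeff (select Q? P) m ≡ 0ℤ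
    coeff-select-∉ []             m ¬q = refl
    coeff-select-∉ ((c , m′) ∷ P) m ¬q with Q? (sortM m′)
    ... | no _ = coeff-select-∉ P m ¬q
    ... | yes q′ with ≡-dec ℕ._≟_ (sortM m′) (sortM m)
    ...   | yes m′≡m = contradiction (subst Q m′≡m q′) ¬q
    ...   | no  _    = coeff-select-∉ P m ¬q

    evalP-select : ∀ env P → evalP env P ≡ evalP env (select Q? P) + evalP env (select (∁? Q?) P)
    evalP-select env []            = refl
    evalP-select env ((c , m) ∷ P) with Q? (sortM m)
    ... | yes _ = trans (cong (_+_ t) (evalP-select env P)) (sym (+-assoc t (evalP env (select Q? P)) _))
      where
      t : ℤ
      t = c * evalM env m
    ... | no  _ = trans (cong (_+_ t) (evalP-select env P)) (x+[y+z]≡y+[x+z] t (evalP env (select Q? P)) _)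
      where
      t : ℤ
      t = c * evalM env m
      x+[y+z]≡y+[x+z] : ∀ x y z → x + (y + z) ≡ y + (x + z)
      x+[y+z]≡y+[x+z] = solve-∀

  ofMonomial? : (m : Monomial) → Decidable (_≡ sortM m)
  ofMonomial? m s = ≡-dec ℕ._≟_ s (sortM m)

  evalP-select-ofMonomial : ∀ env P m →
    evalP env (select (ofMonomial? m) P) ≡ coeff P m * evalM env (sortM m)
  evalP-select-ofMonomial env []             m = refl
  evalP-select-ofMonomial env ((c , m′) ∷ P) m with ≡-dec ℕ._≟_ (sortM m′) (sortM m)
  ... | no  _    = evalP-select-ofMonomial env P m
  ... | yes m′≡m = begin
    c * evalM env m′ + evalP env (select (ofMonomial? m) P)
      ≡⟨ cong₂ (λ x y → c * x + y) (trans (sym (evalM-sortM env m′)) (cong (evalM env) m′≡m))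
                                  (evalP-select-ofMonomial env P m) ⟩
    c * evalM env (sortM m) + coeff P m * evalM env (sortM m)
      ≡⟨ *-distribʳ-+ (evalM env (sortM m)) c (coeff P m) ⟨
    (c + coeff P m) * evalM env (sortM m) ∎
    where open ≡-Reasoning

  -- The terms sharing the head's monomial contribute coeff P m times its value; the remaining
  -- terms are fewer and keep all other coefficients.
  ∣coeff⇒∣evalP : ∀ {d} env P → (∀ m → d ∣ coeff P m) → d ∣ evalP env P
  ∣coeff⇒∣evalP env P = bounded (length P) P ℕP.≤-refl
    where
    bounded : ∀ {d} n P → length P ℕ.≤ n → (∀ m → d ∣ coeff P m) → d ∣ evalP env P
    bounded _       []                   _              _       = divides 0ℤ refl
    bounded {d} (suc n) P@((c , m) ∷ P′) (ℕ.s≤s |P′|≤n) d∣coeff =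
      subst (d ∣_) (sym (evalP-select (ofMonomial? m) env P))
        (∣m∣n⇒∣m+n (subst (d ∣_) (sym (evalP-select-ofMonomial env P m)) (∣m⇒∣m*n _ (d∣coeff m)))
                   (bounded n rest |rest|≤n d∣coeff-rest))
      where
      other? : Decidable (∁ (_≡ sortM m))
      other? = ∁? (ofMonomial? m)
      rest : Poly
      rest = select other? P
      |rest|≤n : length rest ℕ.≤ n
      |rest|≤n rewrite filter-reject (λ t → other? (sortM (proj₂ t))) {x = c , m} {xs = P′} (λ ≢ → ≢ refl) =
        ℕP.≤-trans (length-filter _ P′) |P′|≤n
      d∣coeff-rest : ∀ m′ → d ∣ coeff rest m′
      d∣coeff-rest m′ with ofMonomial? m (sortM m′)
      ... | yes ≡ = subst (d ∣_) (sym (coeff-select-∉ other? P m′ (λ ≢ → ≢ ≡))) (divides 0ℤ refl)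
      ... | no  ≢ = subst (d ∣_) (sym (coeff-select-∈ other? P m′ ≢)) (d∣coeff m′)

  evalP-cong-≈ : ∀ {p} env P Q → P ≈[ p ] Q → + p ∣ evalP env P - evalP env Q
  evalP-cong-≈ {p} env P Q P≈Q = subst (+ p ∣_) (evalP-⊖ env P Q)
    (∣coeff⇒∣evalP env (P ⊖ Q) (λ m → subst (+ p ∣_) (sym (coeff-⊖ P Q m)) (∣ᵤ⇒∣ (P≈Q m))))

  evalM-cong : ∀ {env env′} m → All (λ v → env v ≡ env′ v) m → evalM env m ≡ evalM env′ m
  evalM-cong []      []                = refl
  evalM-cong (v ∷ m) (v-agrees ∷ agree) = cong₂ _*_ v-agrees (evalM-cong m agree)

  module _ {p : ℕ} (env env′ : ℕ → ℤ) where

    private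
      Agree? : Decidable (All (λ v → env v ≡ env′ v))
      Agree? = All.all? (λ v → env v ℤ.≟ env′ v)

    evalP-select-agree : ∀ P → evalP env (select Agree? P) ≡ evalP env′ (select Agree? P)
    evalP-select-agree []            = refl
    evalP-select-agree ((c , m) ∷ P) with Agree? (sortM m)
    ... | no  _     = evalP-select-agree P
    ... | yes agree = cong₂ (λ x y → c * x + y)
      (trans (sym (evalM-sortM env m)) (trans (evalM-cong (sortM m) agree) (evalM-sortM env′ m)))
      (evalP-select-agree P)

    -- A monomial on which env and env′ disagree contains a variable that does not occur in P,
    -- so its coefficient vanishes modulo p.
    evalP-agree : ∀ P → (∀ v → Occurs p v P → env v ≡ env′ v) → + p ∣ evalP env P - evalP env′ P
    evalP-agree P agree = subst (+ p ∣_) (sym difference)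
      (∣m∣n⇒∣m-n (∣coeff⇒∣evalP env R p∣coeff-R) (∣coeff⇒∣evalP env′ R p∣coeff-R))
      where
      open ≡-Reasoning
      A R : Poly
      A = select Agree? P
      R = select (∁? Agree?) P
      p∣coeff-R : ∀ m → + p ∣ coeff R m
      p∣coeff-R m with Agree? (sortM m)
      ... | yes agrees =
        subst (+ p ∣_) (sym (coeff-select-∉ (∁? Agree?) P m (λ ¬agrees → ¬agrees agrees))) (divides 0ℤ refl)
      ... | no ¬agrees with + p ∣? coeff P m
      ...   | yes p∣ = subst (+ p ∣_) (sym (coeff-select-∈ (∁? Agree?) P m ¬agrees)) p∣
      ...   | no  p∤ = contradiction
        (All.tabulate λ v∈ → agree _ (m , ∈-resp-↭ (sortM-↭ m) v∈ , p∤ ∘ ∣ᵤ⇒∣)) ¬agrees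
      cancel : ∀ a r r′ → (a + r) - (a + r′) ≡ r - r′
      cancel = solve-∀
      difference : evalP env P - evalP env′ P ≡ evalP env R - evalP env′ R
      difference = begin
        evalP env P - evalP env′ P
          ≡⟨ cong₂ _-_ (evalP-select Agree? env P) (evalP-select Agree? env′ P) ⟩
        (evalP env A + evalP env R) - (evalP env′ A + evalP env′ R)
          ≡⟨ cong (λ x → (x + evalP env R) - (evalP env′ A + evalP env′ R)) (evalP-select-agree P) ⟩
        (evalP env′ A + evalP env R) - (evalP env′ A + evalP env′ R)
          ≡⟨ cancel (evalP env′ A) (evalP env R) (evalP env′ R) ⟩
        evalP env R - evalP env′ R ∎

  -- Extension polynomials

  extFactor : ∀ {h} → ExtGroup h → Fin h → Poly
  extFactor G u = oneP ⊖ sumF (λ j → var (r G u j) ⊗ gs G j)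

  ExtVar : ∀ {h} → ExtGroup h → ℕ → Set
  ExtVar G v = ∃₂ λ u j → r G u j ≡ v

  evalP-extPoly : ∀ env {h} (G : ExtGroup h) i →
    evalP env (extPoly G i) ≡ evalP env (gs G i) * product (evalP env ∘ extFactor G)
  evalP-extPoly env G i =
    trans (evalP-⊗ env (gs G i) _) (cong (_*_ (evalP env (gs G i))) (evalP-prodF env (extFactor G)))

  evalP-extFactor : ∀ env {h} (G : ExtGroup h) u →
    evalP env (extFactor G u) ≡ 1ℤ - sum (λ j → env (r G u j) * evalP env (gs G j))
  evalP-extFactor env G u = begin
    evalP env (extFactor G u)                            ≡⟨ evalP-⊖ env oneP (sumF summand) ⟩
    1ℤ - evalP env (sumF summand)                        ≡⟨ cong (_-_ 1ℤ) (evalP-sumF env summand) ⟩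
    1ℤ - sum (evalP env ∘ summand)                       ≡⟨ cong (_-_ 1ℤ) (sum-cong-≗ evalP-summand) ⟩
    1ℤ - sum (λ j → env (r G u j) * evalP env (gs G j)) ∎
    where
    open ≡-Reasoning
    summand : Fin (m G) → Poly
    summand j = var (r G u j) ⊗ gs G j
    evalP-summand : ∀ j → evalP env (summand j) ≡ env (r G u j) * evalP env (gs G j)
    evalP-summand j =
      trans (evalP-⊗ env (var (r G u j)) (gs G j)) (cong (_* evalP env (gs G j)) (evalP-var env (r G u j)))

  assignAt : ∀ {m} → (Fin m → ℕ) → (Fin m → ℤ) → (ℕ → ℤ) → ℕ → ℤ
  assignAt vars vals env v with any? (λ j → vars j ℕ.≟ v)
  ... | yes (j , _) = vals j
  ... | no  _       = env v

  module _ {m} (vars : Fin m → ℕ) (vals : Fin m → ℤ) (env : ℕ → ℤ) where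

    assignAt-hit : (∀ {j j′} → vars j ≡ vars j′ → j ≡ j′) → ∀ j → assignAt vars vals env (vars j) ≡ vals j
    assignAt-hit injective j with any? (λ j′ → vars j′ ℕ.≟ vars j)
    ... | yes (j′ , vars-j′≡vars-j) = cong vals (injective vars-j′≡vars-j)
    ... | no  none                  = contradiction (j , refl) none

    assignAt-miss : ∀ {v} → (∀ j → vars j ≢ v) → assignAt vars vals env v ≡ env v
    assignAt-miss {v} v∉vars with any? (λ j → vars j ℕ.≟ v)
    ... | yes (j , vars-j≡v) = contradiction vars-j≡v (v∉vars j)
    ... | no  _              = refl

  module _ (p : ℕ) where

    Vanishes : (ℕ → ℤ) → Poly → Set
    Vanishes env P = + p ∣ evalP env P

    all-vanish-agree : ∀ {env env′} Ps → (∀ v → OccursIn p v Ps → env v ≡ env′ v) →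
                       All (Vanishes env) Ps → All (Vanishes env′) Ps
    all-vanish-agree []       agree []                       = []
    all-vanish-agree (P ∷ Ps) agree (P-vanishes ∷ Ps-vanish) =
      ∣m-n∣m⇒∣n (evalP-agree _ _ P (λ v → agree v ∘ here)) P-vanishes
        ∷ all-vanish-agree Ps (λ v → agree v ∘ there) Ps-vanish

    extPolys-vanish : ∀ env {h} (G : ExtGroup (suc h)) →
      (∀ j → Vanishes env (gs G j)) ⊎ Vanishes env (extFactor G zero) → All (Vanishes env) (groupPolys G)
    extPolys-vanish env G (inj₁ gs-vanish) = AllP.tabulate⁺ λ i →
      subst (+ p ∣_) (sym (evalP-extPoly env G i)) (∣m⇒∣m*n _ (gs-vanish i))
    extPolys-vanish env G (inj₂ factor-vanishes) = AllP.tabulate⁺ λ i →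
      subst (+ p ∣_) (sym (evalP-extPoly env G i))
        (∣n⇒∣m*n (evalP env (gs G i)) (∣m⇒∣m*n _ factor-vanishes))

    GroupOK-tail : ∀ {h prev G} {L : List (ExtGroup h)} →
      (∀ k → GroupOK p prev (G ∷ L) k) → ∀ k → GroupOK p prev L k
    GroupOK-tail ok k with ok (suc k)
    ... | distinct , gs-in-prev , fresh , apart =
      distinct , gs-in-prev , fresh , λ u j k′ k′≢k → apart u j (suc k′) (k′≢k ∘ suc-injective)

    GroupOK⇒gs-free : ∀ {h prev} {L : List (ExtGroup h)} k → GroupOK p prev L k →
                      ∀ j v → Occurs p v (gs (lookup L k) j) → ¬ ExtVar (lookup L k) v
    GroupOK⇒gs-free k (_ , gs-in-prev , fresh , _) j v v∈g (u , j′ , refl) = fresh u j′ (gs-in-prev j v v∈g)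

    ¬OccursIn-levelPolys : ∀ {h v} (L : List (ExtGroup h)) →
      (∀ k → ¬ OccursIn p v (groupPolys (lookup L k))) → ¬ OccursIn p v (levelPolys L)
    ¬OccursIn-levelPolys []      absent ()
    ¬OccursIn-levelPolys (G ∷ L) absent occ with AnyP.++⁻ (groupPolys G) occ
    ... | inj₁ in-G = absent zero in-G
    ... | inj₂ in-L = ¬OccursIn-levelPolys L (absent ∘ suc) in-L

  module _ {p : ℕ} (p-prime : Prime p) where

    extendGroup : ∀ {h} (G : ExtGroup (suc h)) →
      (∀ u j u′ j′ → r G u j ≡ r G u′ j′ → (u ≡ u′) × (j ≡ j′)) →
      (∀ j v → Occurs p v (gs G j) → ¬ ExtVar G v) →
      ∀ env → Σ (ℕ → ℤ) λ env′ →
        All (Vanishes p env′) (groupPolys G) × (∀ v → ¬ ExtVar G v → env v ≡ env′ v)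
    extendGroup G distinct gs-free env with all? (λ j → + p ∣? evalP env (gs G j))
    ... | yes gs-vanish = env , extPolys-vanish p env G (inj₁ gs-vanish) , λ _ _ → refl
    ... | no ¬gs-vanish with ¬∀⟶∃¬ _ _ (λ j → + p ∣? evalP env (gs G j)) ¬gs-vanish
    ...   | j₀ , p∤g₀ = env′ , extPolys-vanish p env′ G (inj₂ first-factor-vanishes) , unchanged
      where
      open ≡-Reasoning
      g g′ : Fin (m G) → ℤ
      g j = evalP env (gs G j)
      b : ℤ
      b = g j₀ ^ (p ∸ 2)
      vals : Fin (m G) → ℤ
      vals = updateAt (const 0ℤ) j₀ (const b)
      env′ : ℕ → ℤ
      env′ = assignAt (r G zero) vals env
      g′ j = evalP env′ (gs G j)

      unchanged : ∀ v → ¬ ExtVar G v → env v ≡ env′ v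
      unchanged v ¬ext = sym (assignAt-miss (r G zero) vals env (λ j r≡v → ¬ext (zero , j , r≡v)))

      r₀-values : ∀ j → env′ (r G zero j) ≡ vals j
      r₀-values = assignAt-hit (r G zero) vals env (λ r≡r → proj₂ (distinct zero _ zero _ r≡r))

      p∣g′-g : + p ∣ g′ j₀ - g j₀
      p∣g′-g = evalP-agree env′ env (gs G j₀) (λ v occ → sym (unchanged v (gs-free j₀ v occ)))

      r₀-sum : sum (λ j → env′ (r G zero j) * g′ j) ≡ b * g′ j₀
      r₀-sum = begin
        sum (λ j → env′ (r G zero j) * g′ j)
          ≡⟨ sum-single _ j₀ (λ j j≢j₀ → cong (_* g′ j) (trans (r₀-values j) (updateAt-minimal j j₀ _ j≢j₀))) ⟩
        env′ (r G zero j₀) * g′ j₀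
          ≡⟨ cong (_* g′ j₀) (trans (r₀-values j₀) (updateAt-updates j₀ (const 0ℤ))) ⟩
        b * g′ j₀ ∎

      first-factor-vanishes : Vanishes p env′ (extFactor G zero)
      first-factor-vanishes = subst (+ p ∣_) (sym value)
        (∣m⇒∣-m (∣m∣n⇒∣m+n (fermat-inverse p-prime p∤g₀) (∣n⇒∣m*n b p∣g′-g)))
        where
        rearrange : ∀ b g g′ → 1ℤ - b * g′ ≡ - ((b * g - 1ℤ) + b * (g′ - g))
        rearrange = solve-∀
        value : evalP env′ (extFactor G zero) ≡ - ((b * g j₀ - 1ℤ) + b * (g′ j₀ - g j₀))
        value = trans (evalP-extFactor env′ G zero) (trans (cong (_-_ 1ℤ) r₀-sum) (rearrange b (g j₀) (g′ j₀)))

    extendLevel : ∀ {h} prev (L : List (ExtGroup (suc h))) → (∀ k → GroupOK p prev L k) →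
      ∀ env → All (Vanishes p env) prev → Σ (ℕ → ℤ) λ env′ → All (Vanishes p env′) (prev ++ levelPolys L)
    extendLevel prev []      _  env prev-vanish = env , AllP.++⁺ prev-vanish []
    extendLevel prev (G ∷ L) ok env prev-vanish
      with extendLevel prev L (GroupOK-tail p ok) env prev-vanish | ok zero
    ... | env₁ , old-vanish | distinct , _ , fresh , apart
      with extendGroup G distinct (GroupOK⇒gs-free p zero (ok zero)) env₁
    ... | env₂ , G-vanish , unchanged =
      env₂ , AllP.++⁺ (AllP.++⁻ˡ prev old-vanish₂) (AllP.++⁺ G-vanish (AllP.++⁻ʳ prev old-vanish₂))
      where
      old : List Poly
      old = prev ++ levelPolys L
      r-not-old : ∀ u j → ¬ OccursIn p (r G u j) old
      r-not-old u j occ with AnyP.++⁻ prev occ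
      ... | inj₁ in-prev = fresh u j in-prev
      ... | inj₂ in-L    = ¬OccursIn-levelPolys p L (λ k → apart u j (suc k) (λ ())) in-L
      old-vanish₂ : All (Vanishes p env₂) old
      old-vanish₂ = all-vanish-agree p old
        (λ { v occ → unchanged v (λ { (u , j , refl) → r-not-old u j occ }) }) old-vanish

    extendLevels : ∀ {h} prev (Ls : List (List (ExtGroup (suc h)))) → Stratified p prev Ls →
      ∀ env → All (Vanishes p env) prev → Σ (ℕ → ℤ) λ env′ → All (Vanishes p env′) (prev ++ allExtPolys Ls)
    extendLevels prev []       _            env vanish = env , AllP.++⁺ vanish []
    extendLevels prev (L ∷ Ls) (ok , strat) env vanish with extendLevel prev L ok env vanish
    ... | env₁ , vanish₁ with extendLevels (prev ++ levelPolys L) Ls strat env₁ vanish₁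
    ...   | env₂ , vanish₂ =
      env₂ , subst (All (Vanishes p env₂)) (++-assoc prev (levelPolys L) (allExtPolys Ls)) vanish₂

    RPoly-vanishes : ∀ env v → Vanishes p env (powP (var v) p ⊖ var v)
    RPoly-vanishes env v = subst (+ p ∣_) (sym value) (fermat p-prime (env v))
      where
      value : evalP env (powP (var v) p ⊖ var v) ≡ env v ^ p - env v
      value = trans (evalP-⊖ env (powP (var v) p) (var v))
        (cong₂ _-_ (trans (evalP-powP env (var v) p) (cong (_^ p) (evalP-var env v))) (evalP-var env v))

    NS-sound : ∀ {Gs} env → NSRefutation p Gs → ¬ All (Vanishes p env) Gs
    NS-sound {Gs} env (hs , combination≈1) Gs-vanish = p≢1 (ℕ∣.∣1⇒≡1 (∣⇒∣ᵤ (∣m-n∣m⇒∣n p∣S-1 p∣S)))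
      where
      summand : Fin (length Gs) → Poly
      summand i = hs i ⊗ lookup Gs i
      S : Poly
      S = sumF summand
      p∣S : + p ∣ evalP env S
      p∣S = subst (+ p ∣_) (sym (evalP-sumF env summand)) (∣-sum (evalP env ∘ summand) λ i →
        subst (+ p ∣_) (sym (evalP-⊗ env (hs i) (lookup Gs i)))
          (∣n⇒∣m*n (evalP env (hs i)) (All.lookup Gs-vanish (∈-lookup i))))
      p∣S-1 : + p ∣ evalP env S - 1ℤ
      p∣S-1 = evalP-cong-≈ env S oneP combination≈1
      p≢1 : p ≢ 1
      p≢1 p≡1 = ¬prime[1] (subst Prime p≡1 p-prime)

    ENS-sound : ∀ {F} env → ENSRefutation p F → ¬ All (Vanishes p env) F
    ENS-sound env (zero , () , _)
    ENS-sound {F} env (suc h , _ , E , _ , stratified , refutation) F-vanish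
      with extendLevels F E stratified env F-vanish
    ... | env′ , vanish = NS-sound env′ refutation
      (subst (All (Vanishes p env′)) (++-assoc F (allExtPolys E) (RPolys p E))
        (AllP.++⁺ vanish (AllP.map⁺ (All.universal (RPoly-vanishes env′) _))))

open import Data.Integer.Divisibility using (_∣_)
open import Data.Integer.Divisibility.Signed using (∣ᵤ⇒∣)

lemma2p2 : (p : ℕ) → Prime p → (N : ℕ) → (F : List Poly)
    → All (λ f → ∀ v → Occurs p v f → v < N) F
    → (∀ (i : Fin N) → Any (λ f → f ≈[ p ] (powP (var (toℕ i)) 2 ⊖ var (toℕ i))) F)
    → ENSRefutation p F
    → ¬ (Σ (Fin N → Fin p) λ a → All (λ f → (+ p) ∣ evalP (assignEnv a) f) F)
lemma2p2 p p-prime N F _ _ refutation (a , F-vanish) =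
  Soundness.ENS-sound p-prime (assignEnv a) refutation (All.map ∣ᵤ⇒∣ F-vanish)
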